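{- Let $\mathcal F$ and $\mathcal H\subseteq\mathcal F$ be union-closed families over the universe $[n]$. Then $\overline{\mathcal H}\supseteq\mathcal F$ if and only if for all $A\in\mathcal H$ and $B\in\mathcal F$ with $A\subseteq_{\mathcal F}B$, we have $B\in\mathcal H$.
   Context: A family of subsets of $[n]$ is union-closed over $[n]$ if it contains $[n]$ and is closed under pairwise unions; the empty set is never a member of any family, and $2^{[n]}$ denotes all nonempty subsets of $[n]$. The closure of $\mathcal H$ is $\overline{\mathcal H}=\{A\in 2^{[n]}:\ \mathcal H\cup\{A\}\text{ is union-closed}\}$. Relative subsets: for a union-closed $\mathcal F$ and $A,B\in\mathcal F$, $A\subseteq_{\mathcal F}B$ means that $A=B$, or $B=[n]$, or there exists $C\in\mathcal F$ with $C\neq B$ and $A\cup C=B$. -}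

module Defs where

open import Data.Nat using (ℕ)
open import Data.Fin.Subset using (Subset; ⊤; _∪_; Nonempty)
open import Data.Product using (Σ; _×_; ∃)
open import Data.Sum using (_⊎_)
open import Relation.Binary.PropositionalEquality using (_≡_; _≢_)

Family : ℕ → Set₁
Family n = Subset n → Set

_⊆ᶠ_ : ∀ {n} → Family n → Family n → Set
𝓗 ⊆ᶠ 𝓕 = ∀ X → 𝓗 X → 𝓕 X

record UnionClosed {n : ℕ} (𝓕 : Family n) : Set where
  field
    nonempty   : ∀ X → 𝓕 X → Nonempty X
    has-full   : 𝓕 ⊤
    ∪-closed   : ∀ X Y → 𝓕 X → 𝓕 Y → 𝓕 (X ∪ Y)

insert : ∀ {n} → Family n → Subset n → Family n
insert 𝓗 A X = 𝓗 X ⊎ X ≡ A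

Closure : ∀ {n} → Family n → Family n
Closure 𝓗 A = Nonempty A × UnionClosed (insert 𝓗 A)

RelSub : ∀ {n} → Family n → Subset n → Subset n → Set
RelSub 𝓕 A B = A ≡ B ⊎ (B ≡ ⊤ ⊎ ∃ λ C → 𝓕 C × C ≢ B × A ∪ C ≡ B)

-- Adding a set C to a union-closed 𝓗 keeps it union-closed exactly when
-- A ∪ C ∈ 𝓗 ∪ {C} for every A ∈ 𝓗. For C ∈ 𝓕 and A ∪ C ≠ C, the set C itself
-- witnesses A ⊆_𝓕 A ∪ C, and conversely every nontrivial relative inclusion
-- A ⊆_𝓕 B (A ≠ B ≠ [n]) has this shape; so both conditions say the same thing.
module Submission where

open import Defs
open import Data.Nat using (ℕ)
open import Data.Fin.Subset using (Subset; _∪_; Nonempty)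
open import Data.Fin.Subset.Properties using (∪-comm; ∪-idem)
open import Data.Product using (_×_; _,_; proj₂)
open import Data.Sum using (inj₁; inj₂)
open import Data.Bool using (_≟_)
open import Data.Vec.Properties using (≡-dec)
open import Data.Empty using (⊥-elim)
open import Relation.Nullary using (yes; no)
open import Relation.Binary.PropositionalEquality using (_≡_; _≢_; refl; sym; trans; subst)

private
  variable
    n : ℕ

RelUpClosed : Family n → Family n → Set
RelUpClosed 𝓕 𝓗 = ∀ A B → 𝓗 A → 𝓕 B → RelSub 𝓕 A B → 𝓗 B

insert-unionClosed : {𝓗 : Family n} {C : Subset n} → UnionClosed 𝓗 → Nonempty C →
  (∀ A → 𝓗 A → insert 𝓗 C (A ∪ C)) → UnionClosed (insert 𝓗 C)
insert-unionClosed {𝓗 = 𝓗} {C} 𝓗-uc C-ne absorbs = record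
  { nonempty = nonempty ; has-full = inj₁ H.has-full ; ∪-closed = ∪-closed }
  where
  module H = UnionClosed 𝓗-uc
  nonempty : ∀ X → insert 𝓗 C X → Nonempty X
  nonempty X (inj₁ hX)   = H.nonempty X hX
  nonempty X (inj₂ refl) = C-ne
  ∪-closed : ∀ X Y → insert 𝓗 C X → insert 𝓗 C Y → insert 𝓗 C (X ∪ Y)
  ∪-closed X Y (inj₁ hX)    (inj₁ hY)    = inj₁ (H.∪-closed X Y hX hY)
  ∪-closed X .C (inj₁ hX)   (inj₂ refl)  = absorbs X hX
  ∪-closed .C Y (inj₂ refl) (inj₁ hY)    = subst (insert 𝓗 C) (∪-comm Y C) (absorbs Y hY)
  ∪-closed .C .C (inj₂ refl) (inj₂ refl) = inj₂ (∪-idem C)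

∈Closure⇒∪∈ : {𝓗 : Family n} {A C : Subset n} → Closure 𝓗 C → 𝓗 A → A ∪ C ≢ C → 𝓗 (A ∪ C)
∈Closure⇒∪∈ {A = A} {C} (_ , uc) hA A∪C≢C
  with UnionClosed.∪-closed uc A C (inj₁ hA) (inj₂ refl)
... | inj₁ hA∪C = hA∪C
... | inj₂ A∪C≡C = ⊥-elim (A∪C≢C A∪C≡C)

⊆Closure⇒relUpClosed : {𝓕 𝓗 : Family n} → UnionClosed 𝓗 → 𝓕 ⊆ᶠ Closure 𝓗 → RelUpClosed 𝓕 𝓗
⊆Closure⇒relUpClosed 𝓗-uc _ A .A hA _ (inj₁ refl)        = hA
⊆Closure⇒relUpClosed 𝓗-uc _ A B  _  _ (inj₂ (inj₁ refl)) = UnionClosed.has-full 𝓗-uc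
⊆Closure⇒relUpClosed {𝓗 = 𝓗} 𝓗-uc 𝓕⊆𝓗‾ A B hA _ (inj₂ (inj₂ (C , fC , C≢B , A∪C≡B))) =
  subst 𝓗 A∪C≡B (∈Closure⇒∪∈ (𝓕⊆𝓗‾ C fC) hA (λ A∪C≡C → C≢B (trans (sym A∪C≡C) A∪C≡B)))

relUpClosed⇒⊆Closure : {𝓕 𝓗 : Family n} → UnionClosed 𝓕 → UnionClosed 𝓗 → 𝓗 ⊆ᶠ 𝓕 →
  RelUpClosed 𝓕 𝓗 → 𝓕 ⊆ᶠ Closure 𝓗
relUpClosed⇒⊆Closure {𝓕 = 𝓕} {𝓗} 𝓕-uc 𝓗-uc 𝓗⊆𝓕 up C fC =
  C-ne , insert-unionClosed 𝓗-uc C-ne absorbs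
  where
  C-ne : Nonempty C
  C-ne = UnionClosed.nonempty 𝓕-uc C fC
  absorbs : ∀ A → 𝓗 A → insert 𝓗 C (A ∪ C)
  absorbs A hA with ≡-dec _≟_ (A ∪ C) C
  ... | yes A∪C≡C = inj₂ A∪C≡C
  ... | no A∪C≢C  = inj₁ (up A (A ∪ C) hA fA∪C (inj₂ (inj₂ (C , fC , C≢A∪C , refl))))
    where
    fA∪C : 𝓕 (A ∪ C)
    fA∪C = UnionClosed.∪-closed 𝓕-uc A C (𝓗⊆𝓕 A hA) fC
    C≢A∪C : C ≢ A ∪ C
    C≢A∪C C≡A∪C = A∪C≢C (sym C≡A∪C)

proposition2 : (n : ℕ) (𝓕 𝓗 : Family n) → UnionClosed 𝓕 → UnionClosed 𝓗 → 𝓗 ⊆ᶠ 𝓕 →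
    (𝓕 ⊆ᶠ Closure 𝓗 → ∀ A B → 𝓗 A → 𝓕 B → RelSub 𝓕 A B → 𝓗 B)
    × ((∀ A B → 𝓗 A → 𝓕 B → RelSub 𝓕 A B → 𝓗 B) → 𝓕 ⊆ᶠ Closure 𝓗)
proposition2 n 𝓕 𝓗 𝓕-uc 𝓗-uc 𝓗⊆𝓕 =
  ⊆Closure⇒relUpClosed 𝓗-uc , relUpClosed⇒⊆Closure 𝓕-uc 𝓗-uc 𝓗⊆𝓕
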